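{- Let $t$ be a positive integer, $\mu$ a $t$-core partition and $0\le k\le t-1$. Let $\lambda$ be a partition with $t$-core $\mu$ and $|\lambda|=|\mu|+nt$. Then $$|\lambda(k)|+|\lambda(t-k)|-|\mu(k)|-|\mu(t-k)|=2n.$$
   Context: Hook length of a box: boxes to its right in its row, plus below it in its column, plus one; $\mathcal H(\lambda)$ is the multiset of hook lengths; a $t$-core has no hook length divisible by $t$. For an integer $k$, $\lambda(k)=\{h\in\mathcal H(\lambda): h\equiv k\pmod t\}$ as a multiset. The 01-sequence $(z_i)_{i\in\mathbb Z}$: traverse the boundary of the Young diagram from the bottom (infinite vertical ray below the first column) to the right (infinite horizontal ray right of the first row), labelling vertical edges $0$ and horizontal edges $1$, indexed so that $\#\{i\ge0:z_i=0\}=\#\{i<0:z_i=1\}$. Removing a $t$-hook exchanges some $z_i=1,z_{i+t}=0$ into $0,1$; the $t$-core of $\lambda$ is the partition obtained by removing $t$-hooks until impossible (independent of choices). -}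

module Defs where

open import Data.Nat using (ℕ; zero; suc; _+_; _∸_; _<ᵇ_; NonZero)
open import Data.Nat.DivMod using (_%_)
open import Data.Nat.Divisibility using (_∣_)
open import Data.Nat.Properties using (_≟_)
open import Data.Integer as ℤ using (ℤ; +_)
open import Data.List using (List; []; _∷_; map; upTo; _++_; filter; length)
open import Data.Nat.ListAction using (sum)
open import Data.List.Relation.Unary.All using (All)
open import Data.List.Relation.Unary.AllPairs using (AllPairs)
open import Data.Bool using (Bool; true; false; if_then_else_)
open import Data.Product using (Σ; _×_; ∃)
open import Data.Empty using (⊥)
open import Relation.Nullary using (¬_)
open import Relation.Binary.PropositionalEquality using (_≡_; _≢_)
open import Relation.Binary.Construct.Closure.ReflexiveTransitive using (Star)
open import Function.Bundles using (_⇔_)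

record Partition : Set where
  constructor mkPartition
  field
    parts      : List ℕ
    decreasing : AllPairs (λ a b → b Data.Nat.≤ a) parts
    positive   : All (λ a → 0 Data.Nat.< a) parts
open Partition public

size : Partition → ℕ
size λ′ = sum (parts λ′)

partAt : List ℕ → ℕ → ℕ
partAt []       _       = 0
partAt (p ∷ ps) zero    = p
partAt (p ∷ ps) (suc i) = partAt ps i

conj : List ℕ → ℕ → ℕ
conj ps j = length (filter (λ r → j Data.Nat.<? r) ps)

-- hook lengths of the boxes in rows i, i+1, ... (0-indexed row i, column j):
-- arm = λ_i - j - 1, leg = λ'_j - i - 1, hook = arm + leg + 1
hooksAux : List ℕ → ℕ → List ℕ → List ℕ
hooksAux ps i []       = []
hooksAux ps i (r ∷ rs) =
  map (λ j → (r ∸ j ∸ 1) + (conj ps j ∸ i ∸ 1) + 1) (upTo r) ++ hooksAux ps (suc i) rs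

hookLengths : Partition → List ℕ
hookLengths λ′ = hooksAux (parts λ′) 0 (parts λ′)

IsCore : ℕ → Partition → Set
IsCore t μ = All (λ h → ¬ (t ∣ h)) (hookLengths μ)

-- |λ(k)|: number of hook lengths h with h ≡ k (mod t)
countRes : (t : ℕ) → .{{NonZero t}} → Partition → ℕ → ℕ
countRes t λ′ k = length (filter (λ h → (h % t) ≟ (k % t)) (hookLengths λ′))

-- 01-sequence: z_p = 0 iff p = λ_i - i for some row i ≥ 1 (λ_i = 0 for i > ℓ).
-- Written with 0-indexed rows i: p = λ_{i} - (i+1).
-- (Index normalisation #{i≥0 : z_i=0} = #{i<0 : z_i=1} holds for this convention.)
ZeroAt : Partition → ℤ → Set
ZeroAt λ′ p = Σ ℕ (λ i → (+ partAt (parts λ′) i) ℤ.- (+ suc i) ≡ p)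

OneAt : Partition → ℤ → Set
OneAt λ′ p = ¬ ZeroAt λ′ p

RemoveHook : ℕ → Partition → Partition → Set
RemoveHook t λ′ ν = ∃ λ (i : ℤ) →
  OneAt λ′ i × ZeroAt λ′ (i ℤ.+ + t) ×
  ZeroAt ν i × OneAt ν (i ℤ.+ + t) ×
  (∀ j → j ≢ i → j ≢ i ℤ.+ + t → (ZeroAt ν j ⇔ ZeroAt λ′ j))

CoreOf : ℕ → Partition → Partition → Set
CoreOf t λ′ μ = Star (RemoveHook t) λ′ μ × (∀ ν → ¬ RemoveHook t μ ν)

-- Read the boundary of a partition as a 0/1-word: its hooks are exactly the pairs of a 0
-- followed by a 1, the hook length being their distance. Removing a t-hook exchanges a 0 at a
-- with a 1 at a + t. Comparing pairs before and after, the hook (a, a + t) disappears, every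
-- position a + s strictly between loses one hook, of length s if it holds a 1 and t − s if it
-- holds a 0, and all other hook lengths change by ±t. So hook lengths ≡ k and ≡ −k (mod t)
-- together lose [s ≡ k] + [s ≡ −k] for each 0 < s < t, plus 2 for the hook of length t when
-- k ≡ 0: exactly 2 per removal, while |λ| drops by t.

module Submission where

open import Defs
open import Data.Bool using (Bool; true; false; not; if_then_else_)
open import Data.Bool.Properties using (¬-not; not-¬)
open import Data.Empty using (⊥-elim)
import Data.Integer as ℤ
import Data.Integer.Properties as ℤ
import Data.Integer.Tactic.RingSolver as ℤ-Solver
open import Data.List using (List; []; _∷_; map; upTo; applyUpTo; _++_; filter; length)
open import Data.List.Properties using (filter-accept; filter-reject)
import Data.List.Relation.Unary.All as All
open import Data.List.Relation.Unary.All using (All; []; _∷_)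
open import Data.List.Relation.Unary.AllPairs using (AllPairs; []; _∷_)
open import Data.Nat
open import Data.Nat.DivMod using (_%_; n%n≡0; m<n⇒m%n≡m; [m+n]%n≡m%n)
open import Data.Nat.ListAction using (sum)
open import Data.Nat.Properties
import Data.Nat.Tactic.RingSolver as ℕ-Solver
open import Data.Product using (Σ; _,_; proj₁; proj₂)
open import Function.Base using (id; _∘_)
open import Function.Bundles using (Equivalence; mk⇔)
open import Relation.Binary.Construct.Closure.ReflexiveTransitive using (Star; ε; _◅_)
open import Relation.Binary.PropositionalEquality
open import Relation.Nullary using (¬_; Dec; does; yes; no)
open import Relation.Nullary.Decidable using (dec-true; dec-false; does-⇔)
open import Algebra.Properties.CommutativeSemigroup +-commutativeSemigroup using (interchange; x∙yz≈y∙xz; x∙yz≈xz∙y)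

𝟙 : Bool → ℕ
𝟙 true  = 1
𝟙 false = 0

∑< : ℕ → (ℕ → ℕ) → ℕ
∑< zero    f = 0
∑< (suc n) f = f 0 + ∑< n (λ j → f (suc j))

infix 5 ∑<
syntax ∑< n (λ j → e) = ∑[ j < n ] e

∑-cong : ∀ n {f g : ℕ → ℕ} → (∀ j → j < n → f j ≡ g j) → ∑< n f ≡ ∑< n g
∑-cong zero    eq = refl
∑-cong (suc n) eq = cong₂ _+_ (eq 0 z<s) (∑-cong n (λ j j<n → eq (suc j) (s<s j<n)))

∑-zero : ∀ n → ∑[ j < n ] 0 ≡ 0
∑-zero zero    = refl
∑-zero (suc n) = ∑-zero n

∑-one : ∀ n → ∑[ j < n ] 1 ≡ n
∑-one zero    = refl
∑-one (suc n) = cong suc (∑-one n)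

∑-split : ∀ m n f → ∑< (m + n) f ≡ ∑< m f + (∑[ j < n ] f (m + j))
∑-split zero    n f = refl
∑-split (suc m) n f = begin
  f 0 + ∑< (m + n) (λ j → f (suc j))                 ≡⟨ cong (f 0 +_) (∑-split m n (λ j → f (suc j))) ⟩
  f 0 + (∑< m (λ j → f (suc j)) + ∑< n (λ j → f (suc (m + j)))) ≡⟨ +-assoc (f 0) _ _ ⟨
  ∑< (suc m) f + (∑[ j < n ] f (suc m + j))          ∎
  where open ≡-Reasoning

∑-+ : ∀ n f g → ∑[ j < n ] (f j + g j) ≡ ∑< n f + ∑< n g
∑-+ zero    f g = refl
∑-+ (suc n) f g = trans (cong (f 0 + g 0 +_) (∑-+ n (λ j → f (suc j)) (λ j → g (suc j))))
                        (interchange (f 0) (g 0) _ _)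

∑-*ˡ : ∀ n c f → ∑[ j < n ] (c * f j) ≡ c * ∑< n f
∑-*ˡ zero    c f = sym (*-zeroʳ c)
∑-*ˡ (suc n) c f = trans (cong (c * f 0 +_) (∑-*ˡ n c (λ j → f (suc j))))
                         (sym (*-distribˡ-+ c (f 0) _))

∑-last : ∀ n f → ∑< (suc n) f ≡ ∑< n f + f n
∑-last zero    f = +-comm (f 0) 0
∑-last (suc n) f = trans (cong (f 0 +_) (∑-last n (λ j → f (suc j)))) (sym (+-assoc (f 0) _ _))

∑-reverse : ∀ n f → ∑[ j < n ] f (n ∸ j ∸ 1) ≡ ∑< n f
∑-reverse zero    f = refl
∑-reverse (suc n) f = begin
  f n + (∑[ j < n ] f (n ∸ j ∸ 1)) ≡⟨ cong (f n +_) (∑-reverse n f) ⟩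
  f n + ∑< n f                     ≡⟨ +-comm (f n) _ ⟩
  ∑< n f + f n                     ≡⟨ ∑-last n f ⟨
  ∑< (suc n) f                     ∎
  where open ≡-Reasoning

∑-split-at : ∀ a n f → ∑< (a + suc n) f ≡ ∑< a f + (f a + (∑[ e < n ] f (a + suc e)))
∑-split-at a n f = trans (∑-split a (suc n) f)
  (cong (λ z → ∑< a f + (f z + (∑[ e < n ] f (a + suc e)))) (+-identityʳ a))

∑-split-at₂ : ∀ a t′ n f → ∑< (a + suc (t′ + suc n)) f ≡
  ∑< a f + (f a + ((∑[ e < t′ ] f (a + suc e)) + (f (a + suc t′) + (∑[ e < n ] f (a + suc (t′ + suc e))))))
∑-split-at₂ a t′ n f = trans (∑-split-at a (t′ + suc n) f) (cong (λ s → ∑< a f + (f a + s))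
  (trans (∑-split t′ (suc n) (λ e → f (a + suc e)))
         (cong (λ z → ∑< t′ (λ e → f (a + suc e)) + (f (a + suc z) + (∑[ e < n ] f (a + suc (t′ + suc e)))))
               (+-identityʳ t′))))

countᵇ : (ℕ → Bool) → List ℕ → ℕ
countᵇ Q []       = 0
countᵇ Q (x ∷ xs) = 𝟙 (Q x) + countᵇ Q xs

countᵇ-++ : ∀ Q xs ys → countᵇ Q (xs ++ ys) ≡ countᵇ Q xs + countᵇ Q ys
countᵇ-++ Q []       ys = refl
countᵇ-++ Q (x ∷ xs) ys = trans (cong (𝟙 (Q x) +_) (countᵇ-++ Q xs ys)) (sym (+-assoc (𝟙 (Q x)) _ _))

countᵇ-map-upTo : ∀ Q (f : ℕ → ℕ) n → countᵇ Q (map f (upTo n)) ≡ ∑[ j < n ] 𝟙 (Q (f j))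
countᵇ-map-upTo Q f = go id
  where
  go : ∀ g n → countᵇ Q (map f (applyUpTo g n)) ≡ ∑[ j < n ] 𝟙 (Q (f (g j)))
  go g zero    = refl
  go g (suc n) = cong (𝟙 (Q (f (g 0))) +_) (go (g ∘ suc) n)

hasResidue : (t : ℕ) → .{{NonZero t}} → ℕ → ℕ → Bool
hasResidue t k h = does (h % t ≟ k % t)

countRes≡countᵇ : ∀ t .{{_ : NonZero t}} λ′ k → countRes t λ′ k ≡ countᵇ (hasResidue t k) (hookLengths λ′)
countRes≡countᵇ t λ′ k = go (hookLengths λ′)
  where
  go : ∀ hs → length (filter (λ h → h % t ≟ k % t) hs) ≡ countᵇ (hasResidue t k) hs
  go []       = refl
  go (h ∷ hs) with does (h % t ≟ k % t)
  ... | true  = cong suc (go hs)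
  ... | false = go hs

-- 0/1-words with true for 1. Boundaries are read against the direction of the 01-sequence
-- (see boundary), so a hook is a 0 at x followed by a 1 at y > x, of length y − x.
Word : Set
Word = ℕ → Bool

zerosBefore : (ℕ → Bool) → Word → ℕ → ℕ
zerosBefore Q w y = ∑[ x < y ] 𝟙 (not (w x)) * 𝟙 (Q (y ∸ x))

hookPairs : (ℕ → Bool) → Word → ℕ → ℕ
hookPairs Q w n = ∑[ y < n ] 𝟙 (w y) * zerosBefore Q w y

onesCount : (ℕ → Bool) → Word → ℕ → ℕ → ℕ
onesCount Q w d n = ∑[ y < n ] 𝟙 (w y) * 𝟙 (Q (d + y))

module _ (Q : ℕ → Bool) {v w : Word} (v≗w : ∀ m → v m ≡ w m) where

  zerosBefore-cong : ∀ y → zerosBefore Q v y ≡ zerosBefore Q w y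
  zerosBefore-cong y = ∑-cong y (λ x _ → cong (λ b → 𝟙 (not b) * _) (v≗w x))

  hookPairs-cong : ∀ n → hookPairs Q v n ≡ hookPairs Q w n
  hookPairs-cong n = ∑-cong n (λ y _ → cong₂ (λ b z → 𝟙 b * z) (v≗w y) (zerosBefore-cong y))

  onesCount-cong : ∀ d n → onesCount Q v d n ≡ onesCount Q w d n
  onesCount-cong d n = ∑-cong n (λ y _ → cong (λ b → 𝟙 b * _) (v≗w y))

hookPairs-suc : ∀ Q w n →
  hookPairs Q w (suc n) ≡ 𝟙 (not (w 0)) * onesCount Q (w ∘ suc) 1 n + hookPairs Q (w ∘ suc) n
hookPairs-suc Q w n = begin
  𝟙 (w 0) * 0 + (∑[ y < n ] 𝟙 (w (suc y)) * (c * 𝟙 (Q (suc y)) + zerosBefore Q (w ∘ suc) y))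
    ≡⟨ cong₂ _+_ (*-zeroʳ (𝟙 (w 0))) (∑-cong n (λ y _ → distrib (𝟙 (w (suc y))) c _ _)) ⟩
  ∑[ y < n ] (c * (𝟙 (w (suc y)) * 𝟙 (Q (suc y))) + 𝟙 (w (suc y)) * zerosBefore Q (w ∘ suc) y)
    ≡⟨ ∑-+ n _ _ ⟩
  (∑[ y < n ] c * (𝟙 (w (suc y)) * 𝟙 (Q (suc y)))) + hookPairs Q (w ∘ suc) n
    ≡⟨ cong (_+ hookPairs Q (w ∘ suc) n) (∑-*ˡ n c _) ⟩
  c * onesCount Q (w ∘ suc) 1 n + hookPairs Q (w ∘ suc) n ∎
  where
  open ≡-Reasoning
  c = 𝟙 (not (w 0))
  distrib : ∀ a c b l → a * (c * b + l) ≡ c * (a * b) + a * l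
  distrib = ℕ-Solver.solve-∀

hookPairs-leadingOnes : ∀ Q k n (w : Word) → (∀ m → m < k → w m ≡ true) →
  hookPairs Q w (k + n) ≡ hookPairs Q (λ m → w (k + m)) n
hookPairs-leadingOnes Q zero    n w ones = refl
hookPairs-leadingOnes Q (suc k) n w ones = begin
  hookPairs Q w (suc (k + n))
    ≡⟨ hookPairs-suc Q w (k + n) ⟩
  𝟙 (not (w 0)) * onesCount Q (w ∘ suc) 1 (k + n) + hookPairs Q (w ∘ suc) (k + n)
    ≡⟨ cong (λ b → 𝟙 (not b) * onesCount Q (w ∘ suc) 1 (k + n) + hookPairs Q (w ∘ suc) (k + n)) (ones 0 z<s) ⟩
  hookPairs Q (w ∘ suc) (k + n)
    ≡⟨ hookPairs-leadingOnes Q k n (w ∘ suc) (λ m m<k → ones (suc m) (s<s m<k)) ⟩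
  hookPairs Q (λ m → w (suc k + m)) n ∎
  where open ≡-Reasoning

onesCount-suc : ∀ Q w d n → onesCount Q w d (suc n) ≡ 𝟙 (w 0) * 𝟙 (Q (d + 0)) + onesCount Q (w ∘ suc) (suc d) n
onesCount-suc Q w d n = cong (𝟙 (w 0) * 𝟙 (Q (d + 0)) +_)
  (∑-cong n (λ y _ → cong (λ z → 𝟙 (w (suc y)) * 𝟙 (Q z)) (+-suc d y)))

onesCount-leadingOnes : ∀ Q k n d (w : Word) → (∀ m → m < k → w m ≡ true) →
  onesCount Q w d (k + n) ≡ (∑[ y < k ] 𝟙 (Q (d + y))) + onesCount Q (λ m → w (k + m)) (d + k) n
onesCount-leadingOnes Q k n d w ones = trans (∑-split k n _) (cong₂ _+_
  (∑-cong k (λ y y<k → trans (cong (λ b → 𝟙 b * _) (ones y y<k)) (+-identityʳ _)))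
  (∑-cong n (λ y _ → cong (λ z → 𝟙 (w (k + y)) * 𝟙 (Q z)) (sym (+-assoc d k y)))))

-- Net loss of hook pairs (for t-periodic Q) when a 0 at a and a 1 at a + t are exchanged: the
-- pair (a, a + t), the pairs from a to the 1s strictly between and from the 0s strictly between
-- to a + t; all other pairs only change length by t.
removedHooks : (ℕ → Bool) → Word → ℕ → ℕ → ℕ
removedHooks Q w a t′ = 𝟙 (Q (suc t′)) + ((∑[ e < t′ ] 𝟙 (w (a + suc e)) * 𝟙 (Q (suc e)))
                                        + (∑[ e < t′ ] 𝟙 (not (w (a + suc e))) * 𝟙 (Q (t′ ∸ e))))

module Exchange (Q : ℕ → Bool) (t′ a : ℕ) (Q-periodic : ∀ x → Q (x + suc t′) ≡ Q x)
  (v w : Word) (v-a : v a ≡ false) (v-b : v (a + suc t′) ≡ true)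
  (w-a : w a ≡ true) (w-b : w (a + suc t′) ≡ false)
  (v≗w : ∀ m → m ≢ a → m ≢ a + suc t′ → v m ≡ w m) where

  private
    b = a + suc t′

    a<b : a < b
    a<b = m<m+n a z<s

    a≢between : ∀ e → a ≢ a + suc e
    a≢between e eq = m≢1+m+n a (trans eq (+-suc a e))

  agree-below : ∀ x → x < a → v x ≡ w x
  agree-below x x<a = v≗w x (<⇒≢ x<a) (<⇒≢ (<-trans x<a a<b))

  agree-between : ∀ e → e < t′ → v (a + suc e) ≡ w (a + suc e)
  agree-between e e<t′ = v≗w (a + suc e) (a≢between e ∘ sym)
    (λ eq → <⇒≢ e<t′ (suc-injective (+-cancelˡ-≡ a _ _ eq)))

  agree-above : ∀ e → v (a + suc (t′ + suc e)) ≡ w (a + suc (t′ + suc e))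
  agree-above e = v≗w _ (a≢between (t′ + suc e) ∘ sym)
    (λ eq → m≢1+m+n t′ (sym (trans (sym (+-suc t′ e)) (suc-injective (+-cancelˡ-≡ a _ _ eq)))))

  zerosBefore-below : ∀ y → y ≤ a → zerosBefore Q v y ≡ zerosBefore Q w y
  zerosBefore-below y y≤a = ∑-cong y (λ x x<y → cong (λ c → 𝟙 (not c) * 𝟙 (Q (y ∸ x))) (agree-below x (<-≤-trans x<y y≤a)))

  private
    zeroTerm : ℕ → Word → ℕ → ℕ
    zeroTerm y u x = 𝟙 (not (u x)) * 𝟙 (Q (y ∸ x))

    zeroTerm-v-a : ∀ y → zeroTerm y v a ≡ 𝟙 (Q (y ∸ a))
    zeroTerm-v-a y = trans (cong (λ c → 𝟙 (not c) * 𝟙 (Q (y ∸ a))) v-a) (+-identityʳ _)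

    zeroTerm-w-a : ∀ y → zeroTerm y w a ≡ 0
    zeroTerm-w-a y = cong (λ c → 𝟙 (not c) * 𝟙 (Q (y ∸ a))) w-a

    below-agrees : ∀ y → ∑< a (zeroTerm y v) ≡ ∑< a (zeroTerm y w)
    below-agrees y = ∑-cong a (λ x x<a → cong (λ c → 𝟙 (not c) * 𝟙 (Q (y ∸ x))) (agree-below x x<a))

    between-agrees : ∀ y n → n ≤ t′ → ∑[ e < n ] zeroTerm y v (a + suc e) ≡ ∑[ e < n ] zeroTerm y w (a + suc e)
    between-agrees y n n≤t′ = ∑-cong n (λ e e<n →
      cong (λ c → 𝟙 (not c) * 𝟙 (Q (y ∸ (a + suc e)))) (agree-between e (<-≤-trans e<n n≤t′)))

  zerosBefore-between : ∀ e → e < t′ → zerosBefore Q v (a + suc e) ≡ zerosBefore Q w (a + suc e) + 𝟙 (Q (suc e))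
  zerosBefore-between e e<t′ = begin
    ∑< (a + suc e) (zeroTerm y v)
      ≡⟨ ∑-split-at a e (zeroTerm y v) ⟩
    ∑< a (zeroTerm y v) + (zeroTerm y v a + (∑[ x < e ] zeroTerm y v (a + suc x)))
      ≡⟨ cong₂ _+_ (below-agrees y) (cong₂ _+_ (trans (zeroTerm-v-a y) (cong (𝟙 ∘ Q) (m+n∸m≡n a (suc e))))
                                               (between-agrees y e (<⇒≤ e<t′))) ⟩
    ∑< a (zeroTerm y w) + (q + (∑[ x < e ] zeroTerm y w (a + suc x)))
      ≡⟨ x∙yz≈xz∙y (∑< a (zeroTerm y w)) q _ ⟩
    ∑< a (zeroTerm y w) + (0 + (∑[ x < e ] zeroTerm y w (a + suc x))) + q
      ≡⟨ cong (λ z → ∑< a (zeroTerm y w) + (z + (∑[ x < e ] zeroTerm y w (a + suc x))) + q) (zeroTerm-w-a y) ⟨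
    ∑< a (zeroTerm y w) + (zeroTerm y w a + (∑[ x < e ] zeroTerm y w (a + suc x))) + q
      ≡⟨ cong (_+ q) (∑-split-at a e (zeroTerm y w)) ⟨
    ∑< (a + suc e) (zeroTerm y w) + q ∎
    where
    open ≡-Reasoning
    y = a + suc e
    q = 𝟙 (Q (suc e))

  zerosBefore-at-one : zerosBefore Q v b ≡ zerosBefore Q v a + (𝟙 (Q (suc t′)) + (∑[ e < t′ ] 𝟙 (not (v (a + suc e))) * 𝟙 (Q (t′ ∸ e))))
  zerosBefore-at-one = begin
    ∑< b (zeroTerm b v)
      ≡⟨ ∑-split-at a t′ (zeroTerm b v) ⟩
    ∑< a (zeroTerm b v) + (zeroTerm b v a + (∑[ e < t′ ] zeroTerm b v (a + suc e)))
      ≡⟨ cong₂ _+_ (∑-cong a below) (cong₂ _+_ (trans (zeroTerm-v-a b) (cong (𝟙 ∘ Q) (m+n∸m≡n a (suc t′))))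
                                              (∑-cong t′ between)) ⟩
    ∑< a (zeroTerm a v) + (𝟙 (Q (suc t′)) + (∑[ e < t′ ] 𝟙 (not (v (a + suc e))) * 𝟙 (Q (t′ ∸ e)))) ∎
    where
    open ≡-Reasoning
    below : ∀ x → x < a → zeroTerm b v x ≡ zeroTerm a v x
    below x x<a = cong (λ z → 𝟙 (not (v x)) * 𝟙 z) (trans (cong Q (+-∸-comm (suc t′) (<⇒≤ x<a))) (Q-periodic (a ∸ x)))
    between : ∀ e → e < t′ → zeroTerm b v (a + suc e) ≡ 𝟙 (not (v (a + suc e))) * 𝟙 (Q (t′ ∸ e))
    between e _ = cong (λ z → 𝟙 (not (v (a + suc e))) * 𝟙 (Q z)) ([m+n]∸[m+o]≡n∸o a (suc t′) (suc e))

  zerosBefore-above : ∀ e → zerosBefore Q v (a + suc (t′ + suc e)) ≡ zerosBefore Q w (a + suc (t′ + suc e))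
  zerosBefore-above e = begin
    ∑< y (zeroTerm y v)
      ≡⟨ ∑-split-at₂ a t′ e (zeroTerm y v) ⟩
    ∑< a (zeroTerm y v) + (zeroTerm y v a + (∑< t′ (between v) + (zeroTerm y v b + ∑< e (above v))))
      ≡⟨ cong₂ _+_ (below-agrees y) (cong₂ _+_ (trans (zeroTerm-v-a y) (cong 𝟙 Q-y-a))
           (cong₂ _+_ (between-agrees y t′ ≤-refl) (cong₂ _+_ zeroTerm-v-b (∑-cong e (λ x _ → above-agrees x))))) ⟩
    ∑< a (zeroTerm y w) + (q + (∑< t′ (between w) + ∑< e (above w)))
      ≡⟨ cong (∑< a (zeroTerm y w) +_) (x∙yz≈y∙xz q (∑< t′ (between w)) (∑< e (above w))) ⟩
    ∑< a (zeroTerm y w) + (∑< t′ (between w) + (q + ∑< e (above w)))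
      ≡⟨ cong₂ (λ z z′ → ∑< a (zeroTerm y w) + (z + (∑< t′ (between w) + (z′ + ∑< e (above w)))))
           (zeroTerm-w-a y) zeroTerm-w-b ⟨
    ∑< a (zeroTerm y w) + (zeroTerm y w a + (∑< t′ (between w) + (zeroTerm y w b + ∑< e (above w))))
      ≡⟨ ∑-split-at₂ a t′ e (zeroTerm y w) ⟨
    ∑< y (zeroTerm y w) ∎
    where
    open ≡-Reasoning
    y = a + suc (t′ + suc e)
    q = 𝟙 (Q (suc e))
    between above : Word → ℕ → ℕ
    between u x = zeroTerm y u (a + suc x)
    above u x = zeroTerm y u (a + suc (t′ + suc x))
    above-agrees : ∀ x → above v x ≡ above w x
    above-agrees x = cong (λ c → 𝟙 (not c) * 𝟙 (Q (y ∸ (a + suc (t′ + suc x))))) (agree-above x)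
    Q-y-a : Q (y ∸ a) ≡ Q (suc e)
    Q-y-a = trans (cong Q (trans (m+n∸m≡n a _) (+-comm (suc t′) (suc e)))) (Q-periodic (suc e))
    y∸b : y ∸ b ≡ suc e
    y∸b = trans (cong (_∸ b) (sym (+-assoc a (suc t′) (suc e)))) (m+n∸m≡n b (suc e))
    zeroTerm-v-b : zeroTerm y v b ≡ 0
    zeroTerm-v-b = cong (λ c → 𝟙 (not c) * 𝟙 (Q (y ∸ b))) v-b
    zeroTerm-w-b : zeroTerm y w b ≡ q
    zeroTerm-w-b = trans (cong₂ (λ c z → 𝟙 (not c) * 𝟙 (Q z)) w-b y∸b) (+-identityʳ q)

  private
    oneTerm : Word → ℕ → ℕ
    oneTerm u y = 𝟙 (u y) * zerosBefore Q u y

    between-ones : ∑[ e < t′ ] oneTerm v (a + suc e)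
                 ≡ (∑[ e < t′ ] oneTerm w (a + suc e)) + (∑[ e < t′ ] 𝟙 (v (a + suc e)) * 𝟙 (Q (suc e)))
    between-ones = trans (∑-cong t′ term) (∑-+ t′ _ _)
      where
      term : ∀ e → e < t′ → oneTerm v (a + suc e) ≡ oneTerm w (a + suc e) + 𝟙 (v (a + suc e)) * 𝟙 (Q (suc e))
      term e e<t′ = begin
        𝟙 (v y) * zerosBefore Q v y                                ≡⟨ cong (𝟙 (v y) *_) (zerosBefore-between e e<t′) ⟩
        𝟙 (v y) * (zerosBefore Q w y + 𝟙 (Q (suc e)))            ≡⟨ *-distribˡ-+ (𝟙 (v y)) _ _ ⟩
        𝟙 (v y) * zerosBefore Q w y + 𝟙 (v y) * 𝟙 (Q (suc e))   ≡⟨ cong (λ c → 𝟙 c * zerosBefore Q w y + 𝟙 (v y) * 𝟙 (Q (suc e))) (agree-between e e<t′) ⟩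
        𝟙 (w y) * zerosBefore Q w y + 𝟙 (v y) * 𝟙 (Q (suc e))   ∎
        where
        open ≡-Reasoning
        y = a + suc e

  hookPairs-exchange : ∀ n → hookPairs Q v (a + suc (t′ + suc n)) ≡ hookPairs Q w (a + suc (t′ + suc n)) + removedHooks Q v a t′
  hookPairs-exchange n = begin
    ∑< N (oneTerm v)
      ≡⟨ ∑-split-at₂ a t′ n (oneTerm v) ⟩
    ∑< a (oneTerm v) + (oneTerm v a + (∑< t′ (between v) + (oneTerm v b + ∑< n (above v))))
      ≡⟨ cong₂ _+_ below (cong₂ _+_ oneTerm-v-a (cong₂ _+_ between-ones (cong₂ _+_ oneTerm-v-b (∑-cong n (λ e _ → above-agrees e))))) ⟩
    B + ((M + X) + ((L + (T + Y)) + A))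
      ≡⟨ regroup B M X L T Y A ⟩
    B + (L + (M + A)) + (T + (X + Y))
      ≡⟨ cong₂ (λ z z′ → B + (z + (M + (z′ + A))) + (T + (X + Y))) oneTerm-w-a oneTerm-w-b ⟨
    ∑< a (oneTerm w) + (oneTerm w a + (∑< t′ (between w) + (oneTerm w b + ∑< n (above w)))) + removedHooks Q v a t′
      ≡⟨ cong (_+ removedHooks Q v a t′) (∑-split-at₂ a t′ n (oneTerm w)) ⟨
    ∑< N (oneTerm w) + removedHooks Q v a t′ ∎
    where
    open ≡-Reasoning
    N = a + suc (t′ + suc n)
    between above : Word → ℕ → ℕ
    between u e = oneTerm u (a + suc e)
    above u e = oneTerm u (a + suc (t′ + suc e))
    B = ∑< a (oneTerm w)
    M = ∑< t′ (between w)
    A = ∑< n (above w)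
    L = zerosBefore Q v a
    T = 𝟙 (Q (suc t′))
    X = ∑[ e < t′ ] 𝟙 (v (a + suc e)) * 𝟙 (Q (suc e))
    Y = ∑[ e < t′ ] 𝟙 (not (v (a + suc e))) * 𝟙 (Q (t′ ∸ e))
    below : ∑< a (oneTerm v) ≡ B
    below = ∑-cong a (λ y y<a → cong₂ (λ c z → 𝟙 c * z) (agree-below y y<a) (zerosBefore-below y (<⇒≤ y<a)))
    oneTerm-v-a : oneTerm v a ≡ 0
    oneTerm-v-a = cong (λ c → 𝟙 c * zerosBefore Q v a) v-a
    oneTerm-w-a : oneTerm w a ≡ L
    oneTerm-w-a = trans (cong (λ c → 𝟙 c * zerosBefore Q w a) w-a) (trans (+-identityʳ _) (sym (zerosBefore-below a ≤-refl)))
    oneTerm-v-b : oneTerm v b ≡ L + (T + Y)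
    oneTerm-v-b = trans (cong (λ c → 𝟙 c * zerosBefore Q v b) v-b) (trans (+-identityʳ _) zerosBefore-at-one)
    oneTerm-w-b : oneTerm w b ≡ 0
    oneTerm-w-b = cong (λ c → 𝟙 c * zerosBefore Q w b) w-b
    above-agrees : ∀ e → above v e ≡ above w e
    above-agrees e = cong₂ (λ c z → 𝟙 c * z) (agree-above e) (zerosBefore-above e)
    regroup : ∀ B M X L T Y A → B + ((M + X) + ((L + (T + Y)) + A)) ≡ B + (L + (M + A)) + (T + (X + Y))
    regroup = ℕ-Solver.solve-∀

𝟙-select : ∀ c x y → 𝟙 c * x + 𝟙 (not c) * y ≡ (if c then x else y)
𝟙-select true  x y = trans (+-identityʳ _) (+-identityʳ x)
𝟙-select false x y = +-identityʳ y

∑-𝟙-≟ : ∀ n c → 0 < c → c ≤ n → ∑[ e < n ] 𝟙 (does (suc e ≟ c)) ≡ 1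
∑-𝟙-≟ (suc n) (suc zero)    _ _         = cong suc (∑-zero n)
∑-𝟙-≟ (suc n) (suc (suc c)) _ (s≤s c<n) = ∑-𝟙-≟ n (suc c) z<s c<n

removedHooks-all : ∀ w a t′ → removedHooks (λ _ → true) w a t′ ≡ suc t′
removedHooks-all w a t′ = cong suc (begin
  (∑[ e < t′ ] 𝟙 (w (a + suc e)) * 1) + (∑[ e < t′ ] 𝟙 (not (w (a + suc e))) * 1)
    ≡⟨ ∑-+ t′ _ _ ⟨
  ∑[ e < t′ ] (𝟙 (w (a + suc e)) * 1 + 𝟙 (not (w (a + suc e))) * 1)
    ≡⟨ ∑-cong t′ (λ e _ → trans (𝟙-select (w (a + suc e)) 1 1) (if-same (w (a + suc e)))) ⟩
  ∑[ e < t′ ] 1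
    ≡⟨ ∑-one t′ ⟩
  t′ ∎)
  where
  open ≡-Reasoning
  if-same : ∀ c → (if c then 1 else 1) ≡ 1
  if-same true  = refl
  if-same false = refl

module _ (t′ : ℕ) where

  private
    t = suc t′

    residue-small : ∀ c x → x < t → c < t → hasResidue t c x ≡ does (x ≟ c)
    residue-small c x x<t c<t = cong₂ (λ m n → does (m ≟ n)) (m<n⇒m%n≡m x<t) (m<n⇒m%n≡m c<t)

    residue-nonzero : ∀ c x → 0 < x → x < t → c % t ≡ 0 → hasResidue t c x ≡ false
    residue-nonzero c x 0<x x<t c≡0 = dec-false (x % t ≟ c % t)
      (λ eq → <⇒≢ 0<x (sym (trans (sym (m<n⇒m%n≡m x<t)) (trans eq c≡0))))

    e<t′⇒0<t′∸e : ∀ {e} → e < t′ → 0 < t′ ∸ e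
    e<t′⇒0<t′∸e = m<n⇒0<n∸m

    t′∸e<t : ∀ e → t′ ∸ e < t
    t′∸e<t e = s≤s (m∸n≤m t′ e)

  removedHooks-multiple : ∀ c w a → c % t ≡ 0 → removedHooks (hasResidue t c) w a t′ ≡ 1
  removedHooks-multiple c w a c≡0 = cong₂ _+_ at-t (cong₂ _+_
    (trans (∑-cong t′ (λ e e<t′ → trans (cong (λ q → 𝟙 (w (a + suc e)) * 𝟙 q)
                                              (residue-nonzero c (suc e) z<s (s<s e<t′) c≡0))
                                        (*-zeroʳ (𝟙 (w (a + suc e))))))
           (∑-zero t′))
    (trans (∑-cong t′ (λ e e<t′ → trans (cong (λ q → 𝟙 (not (w (a + suc e))) * 𝟙 q)
                                              (residue-nonzero c (t′ ∸ e) (e<t′⇒0<t′∸e e<t′) (t′∸e<t e) c≡0))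
                                        (*-zeroʳ (𝟙 (not (w (a + suc e)))))))
           (∑-zero t′)))
    where
    at-t : 𝟙 (hasResidue t c t) ≡ 1
    at-t = cong 𝟙 (dec-true (t % t ≟ c % t) (trans (n%n≡0 t) (sym c≡0)))

  private
    complement-⇔ : ∀ {x x′ c c′} → x + x′ ≡ t → c + c′ ≡ t → x′ ≡ c → x ≡ c′
    complement-⇔ {x} {x′} {c} {c′} x+x′ c+c′ x′≡c = +-cancelʳ-≡ c x c′ (begin
      x + c   ≡⟨ cong (x +_) x′≡c ⟨
      x + x′  ≡⟨ trans x+x′ (sym c+c′) ⟩
      c + c′  ≡⟨ +-comm c c′ ⟩
      c′ + c  ∎)
      where open ≡-Reasoning

  removedHooks-complementary : ∀ c w a → 0 < c → c < t →
    removedHooks (hasResidue t c) w a t′ + removedHooks (hasResidue t (t ∸ c)) w a t′ ≡ 2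
  removedHooks-complementary c w a 0<c c<t = begin
    (𝟙 (H c t) + (X c + Y c)) + (𝟙 (H c′ t) + (X c′ + Y c′))
      ≡⟨ cong₂ (λ p q → (𝟙 p + (X c + Y c)) + (𝟙 q + (X c′ + Y c′))) (at-t c 0<c c<t) (at-t c′ 0<c′ c′<t) ⟩
    (X c + Y c) + (X c′ + Y c′)
      ≡⟨ cong₂ _+_ (∑-+ t′ _ _) (∑-+ t′ _ _) ⟨
    ∑< t′ (λ e → x c e + y c e) + ∑< t′ (λ e → x c′ e + y c′ e)
      ≡⟨ ∑-+ t′ _ _ ⟨
    ∑[ e < t′ ] ((x c e + y c e) + (x c′ e + y c′ e))
      ≡⟨ ∑-cong t′ term ⟩
    ∑[ e < t′ ] (𝟙 (does (suc e ≟ c)) + 𝟙 (does (suc e ≟ c′)))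
      ≡⟨ ∑-+ t′ _ _ ⟩
    (∑[ e < t′ ] 𝟙 (does (suc e ≟ c))) + (∑[ e < t′ ] 𝟙 (does (suc e ≟ c′)))
      ≡⟨ cong₂ _+_ (∑-𝟙-≟ t′ c 0<c (≤-pred c<t)) (∑-𝟙-≟ t′ c′ 0<c′ (≤-pred c′<t)) ⟩
    2 ∎
    where
    open ≡-Reasoning
    H = hasResidue t
    c′ = t ∸ c
    0<c′ : 0 < c′
    0<c′ = m<n⇒0<n∸m c<t
    c′<t : c′ < t
    c′<t = ∸-monoʳ-< 0<c (<⇒≤ c<t)
    X Y : ℕ → ℕ
    X d = ∑[ e < t′ ] 𝟙 (w (a + suc e)) * 𝟙 (H d (suc e))
    Y d = ∑[ e < t′ ] 𝟙 (not (w (a + suc e))) * 𝟙 (H d (t′ ∸ e))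
    x y : ℕ → ℕ → ℕ
    x d e = 𝟙 (w (a + suc e)) * 𝟙 (H d (suc e))
    y d e = 𝟙 (not (w (a + suc e))) * 𝟙 (H d (t′ ∸ e))
    at-t : ∀ d → 0 < d → d < t → H d t ≡ false
    at-t d 0<d d<t = dec-false (t % t ≟ d % t) (λ eq → <⇒≢ 0<d (trans (sym (n%n≡0 t)) (trans eq (m<n⇒m%n≡m d<t))))
    c+c′ : c + c′ ≡ t
    c+c′ = m+[n∸m]≡n (<⇒≤ c<t)
    term : ∀ e → e < t′ → (x c e + y c e) + (x c′ e + y c′ e) ≡ 𝟙 (does (suc e ≟ c)) + 𝟙 (does (suc e ≟ c′))
    term e e<t′ = begin
      (x c e + y c e) + (x c′ e + y c′ e)
        ≡⟨ cong₂ _+_ (𝟙-select bit _ _) (𝟙-select bit _ _) ⟩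
      (if bit then 𝟙 (H c s) else 𝟙 (H c r)) + (if bit then 𝟙 (H c′ s) else 𝟙 (H c′ r))
        ≡⟨ cong₂ (λ p q → (if bit then p else 𝟙 (H c r)) + (if bit then q else 𝟙 (H c′ r))) (small c s<t c<t) (small c′ s<t c′<t) ⟩
      (if bit then 𝟙 (does (s ≟ c)) else 𝟙 (H c r)) + (if bit then 𝟙 (does (s ≟ c′)) else 𝟙 (H c′ r))
        ≡⟨ cong₂ (λ p q → (if bit then 𝟙 (does (s ≟ c)) else p) + (if bit then 𝟙 (does (s ≟ c′)) else q))
             (trans (small c r<t c<t) (cong 𝟙 (does-⇔ (mk⇔ (complement-⇔ s+r c+c′) (complement-⇔ r+s c′+c)) (r ≟ c) (s ≟ c′))))
             (trans (small c′ r<t c′<t) (cong 𝟙 (does-⇔ (mk⇔ (complement-⇔ s+r c′+c) (complement-⇔ r+s c+c′)) (r ≟ c′) (s ≟ c)))) ⟩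
      (if bit then 𝟙 (does (s ≟ c)) else 𝟙 (does (s ≟ c′))) + (if bit then 𝟙 (does (s ≟ c′)) else 𝟙 (does (s ≟ c)))
        ≡⟨ both bit ⟩
      𝟙 (does (s ≟ c)) + 𝟙 (does (s ≟ c′)) ∎
      where
      bit = w (a + suc e)
      s = suc e
      r = t′ ∸ e
      s<t : s < t
      s<t = s<s e<t′
      r<t : r < t
      r<t = t′∸e<t e
      s+r : s + r ≡ t
      s+r = cong suc (m+[n∸m]≡n (<⇒≤ e<t′))
      r+s : r + s ≡ t
      r+s = trans (+-comm r s) s+r
      c′+c : c′ + c ≡ t
      c′+c = trans (+-comm c′ c) c+c′
      small : ∀ d {z} → z < t → d < t → 𝟙 (H d z) ≡ 𝟙 (does (z ≟ d))
      small d {z} z<t d<t = cong 𝟙 (residue-small d z z<t d<t)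
      both : ∀ b → (if b then 𝟙 (does (s ≟ c)) else 𝟙 (does (s ≟ c′))) + (if b then 𝟙 (does (s ≟ c′)) else 𝟙 (does (s ≟ c)))
                 ≡ 𝟙 (does (s ≟ c)) + 𝟙 (does (s ≟ c′))
      both true  = refl
      both false = +-comm (𝟙 (does (s ≟ c′))) (𝟙 (does (s ≟ c)))

  removedHooks-residuePair : ∀ k w a → k < t →
    removedHooks (hasResidue t k) w a t′ + removedHooks (hasResidue t (t ∸ k)) w a t′ ≡ 2
  removedHooks-residuePair zero    w a _   = cong₂ _+_ (removedHooks-multiple 0 w a refl)
                                                       (removedHooks-multiple t w a (n%n≡0 t))
  removedHooks-residuePair (suc k) w a k<t = removedHooks-complementary (suc k) w a z<s k<t

Decreasing : List ℕ → Set
Decreasing = AllPairs (λ a b → b ≤ a)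

-- The boundary of the partition with rows ps at offset h: position m, the index h − 1 − m of the
-- 01-sequence, holds a 0 exactly when m + pᵢ = h + i for a row i (rows beyond the last have length 0).
boundary : List ℕ → ℕ → Word
boundary []       h m = does (m <? h)
boundary (p ∷ ps) h m = if does (m + p ≟ h) then false else boundary ps (suc h) m

boundary-≡ : ∀ {p} ps {h m} → m + p ≡ h → boundary (p ∷ ps) h m ≡ false
boundary-≡ {p} ps {h} {m} m+p≡h = cong (if_then false else boundary ps (suc h) m) (dec-true (m + p ≟ h) m+p≡h)

boundary-≢ : ∀ {p} ps {h m} → m + p ≢ h → boundary (p ∷ ps) h m ≡ boundary ps (suc h) m
boundary-≢ {p} ps {h} {m} m+p≢h = cong (if_then false else boundary ps (suc h) m) (dec-false (m + p ≟ h) m+p≢h)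

boundary-shift : ∀ ps k h m → boundary ps (k + h) (k + m) ≡ boundary ps h m
boundary-shift ps zero    h m = refl
boundary-shift ps (suc k) h m = trans (shift₁ ps (k + h) (k + m)) (boundary-shift ps k h m)
  where
  shift₁ : ∀ ps h m → boundary ps (suc h) (suc m) ≡ boundary ps h m
  shift₁ []       h m = refl
  shift₁ (p ∷ ps) h m = cong (if does (m + p ≟ h) then false else_) (shift₁ ps (suc h) m)

partAt0-≤ : ∀ {q} rs → All (_≤ q) rs → partAt rs 0 ≤ q
partAt0-≤ []       _        = z≤n
partAt0-≤ (r ∷ rs) (r≤q ∷ _) = r≤q

partAt-≤-partAt0 : ∀ ps → Decreasing ps → ∀ i → partAt ps i ≤ partAt ps 0
partAt-≤-partAt0 []       _             i       = z≤n
partAt-≤-partAt0 (p ∷ ps) _             zero    = ≤-refl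
partAt-≤-partAt0 (p ∷ ps) (ps≤p ∷ ps↓) (suc i) = ≤-trans (partAt-≤-partAt0 ps ps↓ i) (partAt0-≤ ps ps≤p)

partAt0-≥ : ∀ rs → Decreasing rs → All (_≤ partAt rs 0) rs
partAt0-≥ []       _         = []
partAt0-≥ (r ∷ rs) (rs≤r ∷ _) = ≤-refl ∷ rs≤r

boundary-leadingOnes : ∀ ps → Decreasing ps → ∀ h m → m + partAt ps 0 < h → boundary ps h m ≡ true
boundary-leadingOnes []       _           h m m<h = dec-true (m <? h) (subst (_< h) (+-identityʳ m) m<h)
boundary-leadingOnes (p ∷ ps) (ps≤p ∷ ps↓) h m m+p<h = trans (boundary-≢ ps (<⇒≢ m+p<h))
  (boundary-leadingOnes ps ps↓ (suc h) m (m≤n⇒m≤1+n (≤-<-trans (+-monoʳ-≤ m (partAt0-≤ ps ps≤p)) m+p<h)))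

boundary-trailingZeros : ∀ ps h m → h + length ps ≤ m → boundary ps h m ≡ false
boundary-trailingZeros []       h m h≤m = dec-false (m <? h) (≤⇒≯ (subst (_≤ m) (+-identityʳ h) h≤m))
boundary-trailingZeros (p ∷ ps) h m h+l≤m with m + p ≟ h
... | yes m+p≡h = boundary-≡ ps m+p≡h
... | no  m+p≢h = trans (boundary-≢ ps m+p≢h) (boundary-trailingZeros ps (suc h) m (subst (_≤ m) (+-suc h (length ps)) h+l≤m))

boundary-firstRow : ∀ q rs → boundary (q ∷ rs) q 0 ≡ false
boundary-firstRow q rs = boundary-≡ rs refl

boundary-tail : ∀ q rs m → boundary (q ∷ rs) q (suc m) ≡ boundary rs q m
boundary-tail q rs m = trans (boundary-≢ rs (m≢1+n+m q ∘ sym)) (boundary-shift rs 1 q m)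

boundary-offset : ∀ ps {h} → partAt ps 0 ≤ h → ∀ m → boundary ps h (h ∸ partAt ps 0 + m) ≡ boundary ps (partAt ps 0) m
boundary-offset ps {h} r≤h m =
  trans (cong (λ h′ → boundary ps h′ (h ∸ partAt ps 0 + m)) (sym (m∸n+n≡m r≤h))) (boundary-shift ps (h ∸ partAt ps 0) _ m)

conj-< : ∀ p qs j → j < p → conj (p ∷ qs) j ≡ suc (conj qs j)
conj-< p qs j j<p = cong length (filter-accept (j <?_) j<p)

conj-≥ : ∀ rs j → All (_≤ j) rs → conj rs j ≡ 0
conj-≥ []       j []            = refl
conj-≥ (r ∷ rs) j (r≤j ∷ rs≤j) = trans (cong length (filter-reject (j <?_) (≤⇒≯ r≤j))) (conj-≥ rs j rs≤j)

firstRowHook : List ℕ → ℕ → ℕ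
firstRowHook ps j = (partAt ps 0 ∸ j ∸ 1) + (conj ps j ∸ 0 ∸ 1) + 1

firstRowCount : (ℕ → Bool) → ℕ → List ℕ → ℕ
firstRowCount Q d ps = ∑[ j < partAt ps 0 ] 𝟙 (Q (d + firstRowHook ps j))

∸-suc-split : ∀ {q r j} → j < r → r ≤ q → q ∸ j ∸ 1 ≡ (q ∸ r) + (r ∸ j ∸ 1)
∸-suc-split {q} {r} {j} j<r r≤q = begin
  q ∸ j ∸ 1              ≡⟨ ∸-suc q j ⟩
  q ∸ suc j              ≡⟨ cong (_∸ suc j) (m∸n+n≡m r≤q) ⟨
  (q ∸ r) + r ∸ suc j    ≡⟨ +-∸-assoc (q ∸ r) j<r ⟩
  (q ∸ r) + (r ∸ suc j)  ≡⟨ cong ((q ∸ r) +_) (∸-suc r j) ⟨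
  (q ∸ r) + (r ∸ j ∸ 1)  ∎
  where
  open ≡-Reasoning
  ∸-suc : ∀ x j → x ∸ j ∸ 1 ≡ x ∸ suc j
  ∸-suc x j = trans (∸-+-assoc x j 1) (cong (x ∸_) (+-comm j 1))

firstRowHook-cons : ∀ q rs → All (_≤ q) rs → ∀ j → j < partAt rs 0 →
  firstRowHook (q ∷ rs) j ≡ suc (q ∸ partAt rs 0 + firstRowHook rs j)
firstRowHook-cons q (r ∷ rs) (r≤q ∷ _) j j<r
  rewrite conj-< q (r ∷ rs) j (<-≤-trans j<r r≤q) | conj-< r rs j j<r | ∸-suc-split j<r r≤q
  = regroup (q ∸ r) (r ∸ j ∸ 1) (conj rs j)
  where
  regroup : ∀ a b c → a + b + suc c + 1 ≡ suc (a + (b + c + 1))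
  regroup = ℕ-Solver.solve-∀

firstRowCount-cons : ∀ q rs → Decreasing (q ∷ rs) → ∀ Q d →
  firstRowCount Q d (q ∷ rs) ≡
  (∑[ y < q ∸ partAt rs 0 ] 𝟙 (Q (suc d + y))) + firstRowCount Q (suc d + (q ∸ partAt rs 0)) rs
firstRowCount-cons q rs (rs≤q ∷ rs↓) Q d = begin
  ∑< q F                                             ≡⟨ cong (λ n → ∑< n F) (m+[n∸m]≡n r≤q) ⟨
  ∑< (r + e) F                                       ≡⟨ ∑-split r e F ⟩
  ∑< r F + (∑[ y < e ] F (r + y))                    ≡⟨ cong₂ _+_ (∑-cong r row) (∑-cong e column) ⟩
  firstRowCount Q (suc d + e) rs + (∑[ y < e ] G (e ∸ y ∸ 1)) ≡⟨ cong (firstRowCount Q (suc d + e) rs +_) (∑-reverse e G) ⟩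
  firstRowCount Q (suc d + e) rs + ∑< e G            ≡⟨ +-comm _ (∑< e G) ⟩
  ∑< e G + firstRowCount Q (suc d + e) rs            ∎
  where
  open ≡-Reasoning
  r = partAt rs 0
  e = q ∸ r
  r≤q : r ≤ q
  r≤q = partAt0-≤ rs rs≤q
  F G : ℕ → ℕ
  F j = 𝟙 (Q (d + firstRowHook (q ∷ rs) j))
  G y = 𝟙 (Q (suc d + y))
  row : ∀ j → j < r → F j ≡ 𝟙 (Q (suc d + e + firstRowHook rs j))
  row j j<r = cong (𝟙 ∘ Q) (begin
    d + firstRowHook (q ∷ rs) j       ≡⟨ cong (d +_) (firstRowHook-cons q rs rs≤q j j<r) ⟩
    d + suc (e + firstRowHook rs j)   ≡⟨ +-suc d _ ⟩
    suc (d + (e + firstRowHook rs j)) ≡⟨ cong suc (+-assoc d e _) ⟨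
    suc d + e + firstRowHook rs j     ∎)
  column : ∀ y → y < e → F (r + y) ≡ G (e ∸ y ∸ 1)
  column y y<e = cong (𝟙 ∘ Q) (begin
    d + ((q ∸ (r + y) ∸ 1) + (conj (q ∷ rs) (r + y) ∸ 1) + 1)
      ≡⟨ cong₂ (λ a c → d + ((a ∸ 1) + (c ∸ 1) + 1)) arm leg ⟩
    d + ((e ∸ y ∸ 1) + 0 + 1)
      ≡⟨ tidy d (e ∸ y ∸ 1) ⟩
    suc d + (e ∸ y ∸ 1) ∎)
    where
    r+y<q : r + y < q
    r+y<q = subst (r + y <_) (m+[n∸m]≡n r≤q) (+-monoʳ-< r y<e)
    arm : q ∸ (r + y) ≡ e ∸ y
    arm = trans (cong (_∸ (r + y)) (sym (m+[n∸m]≡n r≤q))) ([m+n]∸[m+o]≡n∸o r e y)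
    leg : conj (q ∷ rs) (r + y) ≡ 1
    leg = trans (conj-< q rs (r + y) r+y<q)
                (cong suc (conj-≥ rs (r + y) (All.map (λ s≤r → ≤-trans s≤r (m≤m+n r y)) (partAt0-≥ rs rs↓))))
    tidy : ∀ d z → d + (z + 0 + 1) ≡ suc d + z
    tidy = ℕ-Solver.solve-∀

module _ {ps : List ℕ} (ps↓ : Decreasing ps) {h : ℕ} (r≤h : partAt ps 0 ≤ h) where

  boundary-beforeOffset : ∀ m → m < h ∸ partAt ps 0 → boundary ps h m ≡ true
  boundary-beforeOffset m m<k = boundary-leadingOnes ps ps↓ h m (subst (m + partAt ps 0 <_) (m∸n+n≡m r≤h) (+-monoˡ-< _ m<k))

  window-split : ∀ l → h + l ≡ h ∸ partAt ps 0 + (partAt ps 0 + l)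
  window-split l = trans (cong (_+ l) (sym (m∸n+n≡m r≤h))) (+-assoc (h ∸ partAt ps 0) _ l)

mutual
  onesCount-boundary : ∀ ps → Decreasing ps → ∀ Q d →
    onesCount Q (boundary ps (partAt ps 0)) d (partAt ps 0 + length ps) ≡ firstRowCount Q d ps
  onesCount-boundary []       _   Q d = refl
  onesCount-boundary (q ∷ rs) ps↓ Q d = begin
    onesCount Q w d (q + suc (length rs))
      ≡⟨ cong (onesCount Q w d) (+-suc q (length rs)) ⟩
    onesCount Q w d (suc (q + length rs))
      ≡⟨ onesCount-suc Q w d (q + length rs) ⟩
    𝟙 (w 0) * 𝟙 (Q (d + 0)) + onesCount Q (w ∘ suc) (suc d) (q + length rs)
      ≡⟨ cong₂ (λ b n → 𝟙 b * 𝟙 (Q (d + 0)) + n) (boundary-firstRow q rs) (onesCount-cong Q (boundary-tail q rs) (suc d) (q + length rs)) ⟩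
    onesCount Q (boundary rs q) (suc d) (q + length rs)
      ≡⟨ onesCount-boundary-below q rs ps↓ Q d ⟩
    firstRowCount Q d (q ∷ rs) ∎
    where
    open ≡-Reasoning
    w = boundary (q ∷ rs) q

  onesCount-boundary-below : ∀ q rs → Decreasing (q ∷ rs) → ∀ Q d →
    onesCount Q (boundary rs q) (suc d) (q + length rs) ≡ firstRowCount Q d (q ∷ rs)
  onesCount-boundary-below q rs ps↓@(rs≤q ∷ rs↓) Q d = begin
    onesCount Q (boundary rs q) (suc d) (q + length rs)
      ≡⟨ cong (onesCount Q (boundary rs q) (suc d)) (window-split rs↓ r≤q (length rs)) ⟩
    onesCount Q (boundary rs q) (suc d) (e + (r + length rs))
      ≡⟨ onesCount-leadingOnes Q e _ (suc d) (boundary rs q) (boundary-beforeOffset rs↓ r≤q) ⟩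
    (∑[ y < e ] 𝟙 (Q (suc d + y))) + onesCount Q (λ m → boundary rs q (e + m)) (suc d + e) (r + length rs)
      ≡⟨ cong ((∑[ y < e ] 𝟙 (Q (suc d + y))) +_) (onesCount-cong Q (boundary-offset rs r≤q) (suc d + e) (r + length rs)) ⟩
    (∑[ y < e ] 𝟙 (Q (suc d + y))) + onesCount Q (boundary rs r) (suc d + e) (r + length rs)
      ≡⟨ cong ((∑[ y < e ] 𝟙 (Q (suc d + y))) +_) (onesCount-boundary rs rs↓ Q (suc d + e)) ⟩
    (∑[ y < e ] 𝟙 (Q (suc d + y))) + firstRowCount Q (suc d + e) rs
      ≡⟨ firstRowCount-cons q rs ps↓ Q d ⟨
    firstRowCount Q d (q ∷ rs) ∎
    where
    open ≡-Reasoning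
    r = partAt rs 0
    e = q ∸ r
    r≤q = partAt0-≤ rs rs≤q

hooksAux-cons : ∀ Q p qs i rs → All (_≤ p) rs → countᵇ Q (hooksAux (p ∷ qs) (suc i) rs) ≡ countᵇ Q (hooksAux qs i rs)
hooksAux-cons Q p qs i []       _            = refl
hooksAux-cons Q p qs i (r ∷ rs) (r≤p ∷ rs≤p) = begin
  countᵇ Q (map (hook (p ∷ qs) (suc i)) (upTo r) ++ hooksAux (p ∷ qs) (suc (suc i)) rs)
    ≡⟨ countᵇ-++ Q (map (hook (p ∷ qs) (suc i)) (upTo r)) _ ⟩
  countᵇ Q (map (hook (p ∷ qs) (suc i)) (upTo r)) + countᵇ Q (hooksAux (p ∷ qs) (suc (suc i)) rs)
    ≡⟨ cong₂ _+_ row (hooksAux-cons Q p qs (suc i) rs rs≤p) ⟩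
  countᵇ Q (map (hook qs i) (upTo r)) + countᵇ Q (hooksAux qs (suc i) rs)
    ≡⟨ countᵇ-++ Q (map (hook qs i) (upTo r)) _ ⟨
  countᵇ Q (map (hook qs i) (upTo r) ++ hooksAux qs (suc i) rs) ∎
  where
  open ≡-Reasoning
  hook : List ℕ → ℕ → ℕ → ℕ
  hook ps i j = (r ∸ j ∸ 1) + (conj ps j ∸ i ∸ 1) + 1
  row : countᵇ Q (map (hook (p ∷ qs) (suc i)) (upTo r)) ≡ countᵇ Q (map (hook qs i) (upTo r))
  row = begin
    countᵇ Q (map (hook (p ∷ qs) (suc i)) (upTo r)) ≡⟨ countᵇ-map-upTo Q _ r ⟩
    ∑[ j < r ] 𝟙 (Q (hook (p ∷ qs) (suc i) j))     ≡⟨ ∑-cong r (λ j j<r → cong (λ c → 𝟙 (Q ((r ∸ j ∸ 1) + (c ∸ suc i ∸ 1) + 1)))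
                                                                         (conj-< p qs j (<-≤-trans j<r r≤p))) ⟩
    ∑[ j < r ] 𝟙 (Q (hook qs i j))                 ≡⟨ countᵇ-map-upTo Q _ r ⟨
    countᵇ Q (map (hook qs i) (upTo r))             ∎

countᵇ-true-hooksAux : ∀ ps i rs → countᵇ (λ _ → true) (hooksAux ps i rs) ≡ sum rs
countᵇ-true-hooksAux ps i []       = refl
countᵇ-true-hooksAux ps i (r ∷ rs) =
  trans (countᵇ-++ (λ _ → true) (map hook (upTo r)) _)
        (cong₂ _+_ (trans (countᵇ-map-upTo (λ _ → true) hook r) (∑-one r)) (countᵇ-true-hooksAux ps (suc i) rs))
  where
  hook : ℕ → ℕ
  hook j = (r ∸ j ∸ 1) + (conj ps j ∸ i ∸ 1) + 1

hookPairs-trailingZeros : ∀ Q n k (w : Word) → (∀ m → n ≤ m → w m ≡ false) → hookPairs Q w (n + k) ≡ hookPairs Q w n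
hookPairs-trailingZeros Q n k w zeros = begin
  hookPairs Q w (n + k)                                         ≡⟨ ∑-split n k _ ⟩
  hookPairs Q w n + (∑[ y < k ] 𝟙 (w (n + y)) * zerosBefore Q w (n + y))
    ≡⟨ cong (hookPairs Q w n +_) (trans (∑-cong k (λ y _ → cong (λ b → 𝟙 b * zerosBefore Q w (n + y)) (zeros (n + y) (m≤m+n n y))))
                                         (∑-zero k)) ⟩
  hookPairs Q w n + 0                                           ≡⟨ +-identityʳ _ ⟩
  hookPairs Q w n                                               ∎
  where open ≡-Reasoning

mutual
  hookPairs-boundary : ∀ ps → Decreasing ps → ∀ {h} → partAt ps 0 ≤ h → ∀ Q →
    hookPairs Q (boundary ps h) (h + length ps) ≡ countᵇ Q (hooksAux ps 0 ps)
  hookPairs-boundary ps ps↓ {h} r≤h Q = begin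
    hookPairs Q (boundary ps h) (h + length ps)
      ≡⟨ cong (hookPairs Q (boundary ps h)) (window-split ps↓ r≤h (length ps)) ⟩
    hookPairs Q (boundary ps h) (h ∸ r + (r + length ps))
      ≡⟨ hookPairs-leadingOnes Q (h ∸ r) _ (boundary ps h) (boundary-beforeOffset ps↓ r≤h) ⟩
    hookPairs Q (λ m → boundary ps h (h ∸ r + m)) (r + length ps)
      ≡⟨ hookPairs-cong Q (boundary-offset ps r≤h) (r + length ps) ⟩
    hookPairs Q (boundary ps r) (r + length ps)
      ≡⟨ hookPairs-boundary-aligned ps ps↓ Q ⟩
    countᵇ Q (hooksAux ps 0 ps) ∎
    where
    open ≡-Reasoning
    r = partAt ps 0

  hookPairs-boundary-aligned : ∀ ps → Decreasing ps → ∀ Q →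
    hookPairs Q (boundary ps (partAt ps 0)) (partAt ps 0 + length ps) ≡ countᵇ Q (hooksAux ps 0 ps)
  hookPairs-boundary-aligned []                      _          Q = refl
  hookPairs-boundary-aligned (q ∷ rs) ps↓@(rs≤q ∷ rs↓) Q = begin
    hookPairs Q w (q + suc (length rs))
      ≡⟨ cong (hookPairs Q w) (+-suc q (length rs)) ⟩
    hookPairs Q w (suc (q + length rs))
      ≡⟨ hookPairs-suc Q w (q + length rs) ⟩
    𝟙 (not (w 0)) * onesCount Q (w ∘ suc) 1 (q + length rs) + hookPairs Q (w ∘ suc) (q + length rs)
      ≡⟨ cong₂ (λ b n → 𝟙 (not b) * onesCount Q (w ∘ suc) 1 (q + length rs) + n)
           (boundary-firstRow q rs) (hookPairs-cong Q (boundary-tail q rs) (q + length rs)) ⟩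
    onesCount Q (w ∘ suc) 1 (q + length rs) + 0 + hookPairs Q (boundary rs q) (q + length rs)
      ≡⟨ cong₂ _+_ (trans (+-identityʳ _) (trans (onesCount-cong Q (boundary-tail q rs) 1 (q + length rs))
                                                  (onesCount-boundary-below q rs ps↓ Q 0)))
                   (hookPairs-boundary rs rs↓ (partAt0-≤ rs rs≤q) Q) ⟩
    firstRowCount Q 0 (q ∷ rs) + countᵇ Q (hooksAux rs 0 rs)
      ≡⟨ cong₂ _+_ (countᵇ-map-upTo Q (firstRowHook (q ∷ rs)) q) (hooksAux-cons Q q rs 0 rs rs≤q) ⟨
    countᵇ Q (map (firstRowHook (q ∷ rs)) (upTo q)) + countᵇ Q (hooksAux (q ∷ rs) 1 rs)
      ≡⟨ countᵇ-++ Q (map (firstRowHook (q ∷ rs)) (upTo q)) _ ⟨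
    countᵇ Q (hooksAux (q ∷ rs) 0 (q ∷ rs)) ∎
    where
    open ≡-Reasoning
    w = boundary (q ∷ rs) q

RowEndAt : List ℕ → ℕ → ℕ → Set
RowEndAt ps h m = Σ ℕ λ i → m + partAt ps i ≡ h + i

boundary≡false⇒RowEndAt : ∀ ps h m → boundary ps h m ≡ false → RowEndAt ps h m
boundary≡false⇒RowEndAt [] h m e = m ∸ h , trans (+-identityʳ m) (sym (m+[n∸m]≡n (≮⇒≥ (refuted (m <? h) e))))
  where
  refuted : ∀ {A : Set} (a? : Dec A) → does a? ≡ false → ¬ A
  refuted (no ¬a) _  = ¬a
  refuted (yes _) ()
boundary≡false⇒RowEndAt (p ∷ ps) h m e with m + p ≟ h
... | yes m+p≡h = 0 , trans m+p≡h (sym (+-identityʳ h))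
... | no  m+p≢h with boundary≡false⇒RowEndAt ps (suc h) m (trans (sym (boundary-≢ ps m+p≢h)) e)
...   | i , eq  = suc i , trans eq (sym (+-suc h i))

RowEndAt⇒boundary≡false : ∀ ps h m → RowEndAt ps h m → boundary ps h m ≡ false
RowEndAt⇒boundary≡false [] h m (i , eq) = dec-false (m <? h) (≤⇒≯ (subst (h ≤_) (trans (sym eq) (+-identityʳ m)) (m≤m+n h i)))
RowEndAt⇒boundary≡false (p ∷ ps) h m (i , eq) with m + p ≟ h
... | yes m+p≡h = boundary-≡ ps m+p≡h
... | no  m+p≢h = trans (boundary-≢ ps m+p≢h) (RowEndAt⇒boundary≡false ps (suc h) m (later i eq))
  where
  later : ∀ i → m + partAt (p ∷ ps) i ≡ h + i → RowEndAt ps (suc h) m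
  later zero    eq = ⊥-elim (m+p≢h (trans eq (+-identityʳ h)))
  later (suc i) eq = i , trans eq (+-suc h i)

hookPairs-window : ∀ ps → Decreasing ps → ∀ {h n} → partAt ps 0 ≤ h → h + length ps ≤ n → ∀ Q →
  hookPairs Q (boundary ps h) n ≡ countᵇ Q (hooksAux ps 0 ps)
hookPairs-window ps ps↓ {h} {n} r≤h h+l≤n Q = begin
  hookPairs Q (boundary ps h) n                                  ≡⟨ cong (hookPairs Q (boundary ps h)) (m+[n∸m]≡n h+l≤n) ⟨
  hookPairs Q (boundary ps h) (h + length ps + (n ∸ (h + length ps)))
    ≡⟨ hookPairs-trailingZeros Q (h + length ps) _ (boundary ps h) (boundary-trailingZeros ps h) ⟩
  hookPairs Q (boundary ps h) (h + length ps)                    ≡⟨ hookPairs-boundary ps ps↓ r≤h Q ⟩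
  countᵇ Q (hooksAux ps 0 ps)                                ∎
  where open ≡-Reasoning

open import Data.Integer using (ℤ; +_)

diff-≡⇒+-≡ : ∀ a b c d → + a ℤ.- + b ≡ + c ℤ.- + d → a + d ≡ c + b
diff-≡⇒+-≡ a b c d eq = ℤ.+-injective (begin
  + a ℤ.+ + d                     ≡⟨ cancel (+ a) (+ b) (+ d) ⟨
  (+ a ℤ.- + b) ℤ.+ (+ b ℤ.+ + d) ≡⟨ cong (ℤ._+ (+ b ℤ.+ + d)) eq ⟩
  (+ c ℤ.- + d) ℤ.+ (+ b ℤ.+ + d) ≡⟨ cancel′ (+ c) (+ d) (+ b) ⟩
  + c ℤ.+ + b                     ∎)
  where
  open ≡-Reasoning
  cancel : ∀ x y z → (x ℤ.- y) ℤ.+ (y ℤ.+ z) ≡ x ℤ.+ z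
  cancel = ℤ-Solver.solve-∀
  cancel′ : ∀ x y z → (x ℤ.- y) ℤ.+ (z ℤ.+ y) ≡ x ℤ.+ z
  cancel′ = ℤ-Solver.solve-∀

+-≡⇒diff-≡ : ∀ a b c d → a + d ≡ c + b → + a ℤ.- + b ≡ + c ℤ.- + d
+-≡⇒diff-≡ a b c d eq = begin
  + a ℤ.- + b                         ≡⟨ extend (+ a) (+ b) (+ d) ⟩
  (+ a ℤ.+ + d) ℤ.- (+ b ℤ.+ + d)     ≡⟨ cong (λ x → + x ℤ.- (+ b ℤ.+ + d)) eq ⟩
  (+ c ℤ.+ + b) ℤ.- (+ b ℤ.+ + d)     ≡⟨ cancel (+ c) (+ b) (+ d) ⟩
  + c ℤ.- + d                         ∎
  where
  open ≡-Reasoning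
  extend : ∀ x y z → x ℤ.- y ≡ (x ℤ.+ z) ℤ.- (y ℤ.+ z)
  extend = ℤ-Solver.solve-∀
  cancel : ∀ x y z → (x ℤ.+ y) ℤ.- (y ℤ.+ z) ≡ x ℤ.- z
  cancel = ℤ-Solver.solve-∀

position : ℕ → ℕ → ℤ
position h m = + h ℤ.- + suc m

position-injective : ∀ h m m′ → position h m ≡ position h m′ → m ≡ m′
position-injective h m m′ eq = suc-injective (sym (+-cancelˡ-≡ h _ _ (diff-≡⇒+-≡ h (suc m) h (suc m′) eq)))

position-rowEnd : ∀ {x h} → x ≤ h → ∀ i → position h (h ∸ x + i) ≡ + x ℤ.- + suc i
position-rowEnd {x} {h} x≤h i = +-≡⇒diff-≡ h (suc (h ∸ x + i)) x (suc i) (begin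
  h + suc i                  ≡⟨ cong (_+ suc i) (m∸n+n≡m x≤h) ⟨
  h ∸ x + x + suc i          ≡⟨ regroup (h ∸ x) x i ⟩
  x + suc (h ∸ x + i)        ∎)
  where
  open ≡-Reasoning
  regroup : ∀ k x i → k + x + suc i ≡ x + suc (k + i)
  regroup = ℕ-Solver.solve-∀

position-+ : ∀ h m t → position h (m + t) ≡ position h m ℤ.- + t
position-+ h m t = shift (+ h) (+ m) (+ t)
  where
  shift : ∀ h m t → h ℤ.- (ℤ.1ℤ ℤ.+ (m ℤ.+ t)) ≡ h ℤ.- (ℤ.1ℤ ℤ.+ m) ℤ.- t
  shift = ℤ-Solver.solve-∀

module _ (λ′ : Partition) (h m : ℕ) where

  private
    rowEnd⇒ : ∀ {x i} → x + suc m ≡ h + suc i → m + x ≡ h + i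
    rowEnd⇒ {x} {i} eq = suc-injective (begin
      suc (m + x)  ≡⟨ cong suc (+-comm m x) ⟩
      suc (x + m)  ≡⟨ +-suc x m ⟨
      x + suc m    ≡⟨ eq ⟩
      h + suc i    ≡⟨ +-suc h i ⟩
      suc (h + i)  ∎)
      where open ≡-Reasoning

    rowEnd⇐ : ∀ {x i} → m + x ≡ h + i → x + suc m ≡ h + suc i
    rowEnd⇐ {x} {i} eq = begin
      x + suc m    ≡⟨ +-suc x m ⟩
      suc (x + m)  ≡⟨ cong suc (+-comm x m) ⟩
      suc (m + x)  ≡⟨ cong suc eq ⟩
      suc (h + i)  ≡⟨ +-suc h i ⟨
      h + suc i    ∎
      where open ≡-Reasoning

  ZeroAt⇒boundary≡false : ZeroAt λ′ (position h m) → boundary (parts λ′) h m ≡ false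
  ZeroAt⇒boundary≡false (i , eq) =
    RowEndAt⇒boundary≡false (parts λ′) h m (i , rowEnd⇒ (diff-≡⇒+-≡ (partAt (parts λ′) i) (suc i) h (suc m) eq))

  boundary≡false⇒ZeroAt : boundary (parts λ′) h m ≡ false → ZeroAt λ′ (position h m)
  boundary≡false⇒ZeroAt e with boundary≡false⇒RowEndAt (parts λ′) h m e
  ... | i , eq = i , +-≡⇒diff-≡ (partAt (parts λ′) i) (suc i) h (suc m) (rowEnd⇐ eq)

≡false-⇔⇒≡ : ∀ {x y : Bool} → (x ≡ false → y ≡ false) → (y ≡ false → x ≡ false) → x ≡ y
≡false-⇔⇒≡ {false} {false} _  _  = refl
≡false-⇔⇒≡ {false} {true}  x⇒y _  = sym (x⇒y refl)
≡false-⇔⇒≡ {true}  {false} _  y⇒x = y⇒x refl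
≡false-⇔⇒≡ {true}  {true}  _  _  = refl

-- On a common window of both boundaries, removing a t-hook is the exchange of a 0 at a and a 1
-- at a + t (the paper's z_{i+t} = 0 and z_i = 1).
removeHook-hookLengths : ∀ t′ λ′ ν → RemoveHook (suc t′) λ′ ν →
  Σ Word λ v → Σ ℕ λ a → ∀ Q → (∀ x → Q (x + suc t′) ≡ Q x) →
    countᵇ Q (hookLengths λ′) ≡ countᵇ Q (hookLengths ν) + removedHooks Q v a t′
removeHook-hookLengths t′ λ′ ν (i , one-λ , zero-λ@(r , _) , zero-ν , one-ν , others) = v , a , counts
  where
  t  = suc t′
  ps = parts λ′
  qs = parts ν
  H  = partAt ps 0 + partAt qs 0
  N  = H + (length ps + length qs)
  v w : Word
  v = boundary ps H
  w = boundary qs H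
  a = H ∸ partAt ps r + r

  position-a : position H a ≡ i ℤ.+ + t
  position-a = trans (position-rowEnd (≤-trans (partAt-≤-partAt0 ps (decreasing λ′) r) (m≤m+n _ _)) r) (proj₂ zero-λ)

  position-b : position H (a + t) ≡ i
  position-b = trans (position-+ H a t) (trans (cong (ℤ._- + t) position-a) (add-sub i (+ t)))
    where
    add-sub : ∀ x y → x ℤ.+ y ℤ.- y ≡ x
    add-sub = ℤ-Solver.solve-∀

  v-a : v a ≡ false
  v-a = ZeroAt⇒boundary≡false λ′ H a (subst (ZeroAt λ′) (sym position-a) zero-λ)

  v-b : v (a + t) ≡ true
  v-b = ¬-not (λ e → one-λ (subst (ZeroAt λ′) position-b (boundary≡false⇒ZeroAt λ′ H (a + t) e)))

  w-a : w a ≡ true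
  w-a = ¬-not (λ e → one-ν (subst (ZeroAt ν) position-a (boundary≡false⇒ZeroAt ν H a e)))

  w-b : w (a + t) ≡ false
  w-b = ZeroAt⇒boundary≡false ν H (a + t) (subst (ZeroAt ν) (sym position-b) zero-ν)

  v≗w : ∀ m → m ≢ a → m ≢ a + t → v m ≡ w m
  v≗w m m≢a m≢b = ≡false-⇔⇒≡
    (λ e → ZeroAt⇒boundary≡false ν H m (Equivalence.from same (boundary≡false⇒ZeroAt λ′ H m e)))
    (λ e → ZeroAt⇒boundary≡false λ′ H m (Equivalence.to same (boundary≡false⇒ZeroAt ν H m e)))
    where
    same = others (position H m)
      (λ eq → m≢b (position-injective H m (a + t) (trans eq (sym position-b))))
      (λ eq → m≢a (position-injective H m a (trans eq (sym position-a))))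

  ps-fits : H + length ps ≤ N
  ps-fits = +-monoʳ-≤ H (m≤m+n _ _)

  qs-fits : H + length qs ≤ N
  qs-fits = +-monoʳ-≤ H (m≤n+m _ _)

  a+t<N : a + t < N
  a+t<N = <-≤-trans (≰⇒> (λ le → not-¬ refl (trans (sym v-b) (boundary-trailingZeros ps H (a + t) le)))) ps-fits

  R = N ∸ suc (a + t)

  N-split : a + suc (t′ + suc R) ≡ N
  N-split = trans (regroup a t′ R) (m+[n∸m]≡n a+t<N)
    where
    regroup : ∀ a t′ R → a + suc (t′ + suc R) ≡ suc (a + suc t′) + R
    regroup = ℕ-Solver.solve-∀

  counts : ∀ Q → (∀ x → Q (x + t) ≡ Q x) → countᵇ Q (hookLengths λ′) ≡ countᵇ Q (hookLengths ν) + removedHooks Q v a t′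
  counts Q Q-periodic = begin
    countᵇ Q (hooksAux ps 0 ps)
      ≡⟨ hookPairs-window ps (decreasing λ′) (m≤m+n _ _) ps-fits Q ⟨
    hookPairs Q v N
      ≡⟨ cong (hookPairs Q v) N-split ⟨
    hookPairs Q v (a + suc (t′ + suc R))
      ≡⟨ Exchange.hookPairs-exchange Q t′ a Q-periodic v w v-a v-b w-a w-b v≗w R ⟩
    hookPairs Q w (a + suc (t′ + suc R)) + removedHooks Q v a t′
      ≡⟨ cong (λ n → hookPairs Q w n + removedHooks Q v a t′) N-split ⟩
    hookPairs Q w N + removedHooks Q v a t′
      ≡⟨ cong (_+ removedHooks Q v a t′) (hookPairs-window qs (decreasing ν) (m≤n+m _ _) qs-fits Q) ⟩
    countᵇ Q (hooksAux qs 0 qs) + removedHooks Q v a t′ ∎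
    where open ≡-Reasoning

starLength : ∀ {A : Set} {R : A → A → Set} {x y} → Star R x y → ℕ
starLength ε        = 0
starLength (_ ◅ xs) = suc (starLength xs)

starLength-additive : ∀ {A : Set} {R : A → A → Set} (W : A → ℕ) c → (∀ {x y} → R x y → W x ≡ W y + c) →
  ∀ {x y} (xs : Star R x y) → W x ≡ W y + starLength xs * c
starLength-additive W c step ε                = sym (+-identityʳ _)
starLength-additive W c step {x} {y} (_◅_ {j = z} r xs) = begin
  W x                                ≡⟨ step r ⟩
  W z + c                            ≡⟨ cong (_+ c) (starLength-additive W c step xs) ⟩
  W y + starLength xs * c + c        ≡⟨ +-assoc (W y) _ c ⟩
  W y + (starLength xs * c + c)      ≡⟨ cong (λ s → W y + s) (+-comm _ c) ⟩
  W y + suc (starLength xs) * c      ∎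
  where open ≡-Reasoning

module _ (t′ : ℕ) where

  private
    t = suc t′

  size-removeHook : ∀ {λ′ ν} → RemoveHook t λ′ ν → size λ′ ≡ size ν + t
  size-removeHook {λ′} {ν} r = begin
    size λ′                                           ≡⟨ countᵇ-true-hooksAux (parts λ′) 0 (parts λ′) ⟨
    countᵇ all (hookLengths λ′)                       ≡⟨ counts all (λ _ → refl) ⟩
    countᵇ all (hookLengths ν) + removedHooks all v a t′ ≡⟨ cong₂ _+_ (countᵇ-true-hooksAux (parts ν) 0 (parts ν)) (removedHooks-all v a t′) ⟩
    size ν + t                                        ∎
    where
    open ≡-Reasoning
    all : ℕ → Bool
    all _ = true
    removal = removeHook-hookLengths t′ λ′ ν r
    v = proj₁ removal
    a = proj₁ (proj₂ removal)
    counts = proj₂ (proj₂ removal)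

  residuePairs : Partition → ℕ → ℕ
  residuePairs λ′ k = countRes t λ′ k + countRes t λ′ (t ∸ k)

  residuePairs-removeHook : ∀ {k} → k < t → ∀ {λ′ ν} → RemoveHook t λ′ ν → residuePairs λ′ k ≡ residuePairs ν k + 2
  residuePairs-removeHook {k} k<t {λ′} {ν} r = begin
    countRes t λ′ k + countRes t λ′ (t ∸ k)
      ≡⟨ cong₂ _+_ (residue k) (residue (t ∸ k)) ⟩
    (countRes t ν k + removedHooks (hasResidue t k) v a t′) + (countRes t ν (t ∸ k) + removedHooks (hasResidue t (t ∸ k)) v a t′)
      ≡⟨ interchange (countRes t ν k) _ _ _ ⟩
    residuePairs ν k + (removedHooks (hasResidue t k) v a t′ + removedHooks (hasResidue t (t ∸ k)) v a t′)
      ≡⟨ cong (λ s → residuePairs ν k + s) (removedHooks-residuePair t′ k v a k<t) ⟩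
    residuePairs ν k + 2 ∎
    where
    open ≡-Reasoning
    removal = removeHook-hookLengths t′ λ′ ν r
    v = proj₁ removal
    a = proj₁ (proj₂ removal)
    counts = proj₂ (proj₂ removal)
    residue : ∀ c → countRes t λ′ c ≡ countRes t ν c + removedHooks (hasResidue t c) v a t′
    residue c = begin
      countRes t λ′ c
        ≡⟨ countRes≡countᵇ t λ′ c ⟩
      countᵇ (hasResidue t c) (hookLengths λ′)
        ≡⟨ counts (hasResidue t c) (λ x → cong (λ y → does (y ≟ c % t)) ([m+n]%n≡m%n x t)) ⟩
      countᵇ (hasResidue t c) (hookLengths ν) + removedHooks (hasResidue t c) v a t′
        ≡⟨ cong (_+ removedHooks (hasResidue t c) v a t′) (countRes≡countᵇ t ν c) ⟨
      countRes t ν c + removedHooks (hasResidue t c) v a t′ ∎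

lemma4p3 : (t : ℕ) → .{{_ : NonZero t}} → (μ : Partition) → IsCore t μ →
    (k : ℕ) → k < t → (λ′ : Partition) → CoreOf t λ′ μ → (n : ℕ) →
    size λ′ ≡ size μ + n * t →
    (+ countRes t λ′ k) ℤ.+ (+ countRes t λ′ (t ∸ k))
      ℤ.- (+ countRes t μ k) ℤ.- (+ countRes t μ (t ∸ k)) ≡ + (2 * n)
lemma4p3 (suc t′) μ _ k k<t λ′ (removals , _) n size-λ′ = begin
  + residuePairs t′ λ′ k ℤ.- + countRes t μ k ℤ.- + countRes t μ (t ∸ k)
    ≡⟨ cong (λ x → + x ℤ.- + countRes t μ k ℤ.- + countRes t μ (t ∸ k)) pairs ⟩
  + (countRes t μ k + countRes t μ (t ∸ k) + 2 * n) ℤ.- + countRes t μ k ℤ.- + countRes t μ (t ∸ k)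
    ≡⟨ cancel (+ countRes t μ k) (+ countRes t μ (t ∸ k)) (+ (2 * n)) ⟩
  + (2 * n) ∎
  where
  open ≡-Reasoning
  t = suc t′
  removed≡n : starLength removals ≡ n
  removed≡n = *-cancelʳ-≡ _ n t (+-cancelˡ-≡ (size μ) _ _
    (trans (sym (starLength-additive {R = RemoveHook t} size t (λ {λ′} {ν} → size-removeHook t′ {λ′} {ν}) removals)) size-λ′))
  pairs : residuePairs t′ λ′ k ≡ residuePairs t′ μ k + 2 * n
  pairs = trans (starLength-additive {R = RemoveHook t} (λ ν → residuePairs t′ ν k) 2 (λ {λ′} {ν} → residuePairs-removeHook t′ k<t {λ′} {ν}) removals)
                (cong (λ s → residuePairs t′ μ k + s) (trans (*-comm (starLength removals) 2) (cong (2 *_) removed≡n)))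
  cancel : ∀ c d e → c ℤ.+ d ℤ.+ e ℤ.- c ℤ.- d ≡ e
  cancel = ℤ-Solver.solve-∀
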